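{- For $n\ge 0$ let $A_{0,n}$ be the total number of leaves in all labeled non-plane 1-2 trees on vertex set $[n]$ (so $A_{0,0}=0$), and let $A_0(z)=\sum_{n\ge0}A_{0,n}\frac{z^n}{n!}$. Then \[A_0(z)=\frac{z-1+\cos z}{1-\sin z}.\]
   Context: A labeled non-plane 1-2 tree on vertex set $[n]=\{1,\dots,n\}$ is a rooted tree whose vertices are bijectively labeled by $[n]$, in which every vertex has at most two children, the label of each non-root vertex is less than the label of its parent, and the children of a vertex are unordered. A leaf is a vertex with no children. -}

module Defs where

open import Data.Nat using (ℕ; zero; suc; _+_; _∸_; _≤ᵇ_; _≡ᵇ_; _%_)
open import Data.Nat.Combinatorics using (_C_)
open import Data.Bool using (Bool; true; false; _∧_; not; if_then_else_)
open import Data.List using (List; []; _∷_; map; concatMap; foldr; filterᵇ; length; upTo)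
open import Data.Bool.ListAction using (and)
open import Data.Nat.ListAction using (sum)
open import Data.Product using (_×_; _,_; proj₁; proj₂)
open import Data.Integer as ℤ using (ℤ; +_; -_)

-- Labeled non-plane 1-2 trees on [n], encoded by their parent map.
--
-- In such a tree every non-root label is smaller than its parent's label,
-- so the root is necessarily the vertex n, and the tree is exactly a map
-- assigning to each non-root vertex i ∈ {1,…,n-1} a parent p(i) with
-- i < p(i) ≤ n (any such map is a rooted tree with root n: following
-- parents strictly increases the label).  Children are unordered, so the
-- parent map determines the (non-plane) tree and vice versa.
-- A tree is represented as the list of its edges (child , parent).

Edges : Set
Edges = List (ℕ × ℕ)

range : ℕ → ℕ → List ℕ
range a b = map (λ j → a + j) (upTo (suc b ∸ a))

vertices : ℕ → List ℕ
vertices n = range 1 n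

parentMaps : ℕ → List Edges
parentMaps n =
  foldr (λ i acc → concatMap (λ rest → map (λ p → (i , p) ∷ rest) (range (suc i) n)) acc)
        ([] ∷ [])
        (range 1 (n ∸ 1))

childCount : Edges → ℕ → ℕ
childCount t v = length (filterᵇ (λ e → proj₂ e ≡ᵇ v) t)

isOneTwo : ℕ → Edges → Bool
isOneTwo n t = and (map (λ v → childCount t v ≤ᵇ 2) (vertices n))

trees12 : ℕ → List Edges
trees12 zero    = []
trees12 (suc m) = filterᵇ (isOneTwo (suc m)) (parentMaps (suc m))

leafCount : ℕ → Edges → ℕ
leafCount n t = length (filterᵇ (λ v → childCount t v ≡ᵇ 0) (vertices n))

A0 : ℕ → ℕ
A0 n = sum (map (leafCount n) (trees12 n))

-- Exponential generating functions, represented by their normalised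
-- coefficient sequences:  f(z) = Σ f n · zⁿ / n!  ↦  f : ℕ → ℤ.

EGF : Set
EGF = ℕ → ℤ

Σ≤ : ℕ → (ℕ → ℤ) → ℤ
Σ≤ zero    f = f 0
Σ≤ (suc n) f = Σ≤ n f ℤ.+ f (suc n)

-- product of EGFs: n! [zⁿ] (f g) = Σ_k (n choose k) f_k g_{n-k}
_⊙_ : EGF → EGF → EGF
(f ⊙ g) n = Σ≤ n (λ k → (+ (n C k)) ℤ.* (f k ℤ.* g (n ∸ k)))

δ : ℕ → ℕ → ℤ
δ a n = if n ≡ᵇ a then + 1 else + 0

zEGF : EGF
zEGF = δ 1

oneEGF : EGF
oneEGF = δ 0

sinEGF : EGF
sinEGF n with n % 4
... | 1 = + 1
... | 3 = - (+ 1)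
... | _ = + 0

cosEGF : EGF
cosEGF n with n % 4
... | 0 = + 1
... | 2 = - (+ 1)
... | _ = + 0

A0EGF : EGF
A0EGF n = + (A0 n)

module Submission where

-- Build a 1-2 tree on [n] by choosing parents for the vertices n-1, …, 1
-- in turn.  Recording only the numbers i of leaves and j of unary vertices,
-- attaching a new vertex below a leaf leads to (i, j+1) and below a unary
-- vertex to (i+1, j-1): the derivation D of the grammar x → x y, y → x.
-- Hence every weight F(i, j) summed over the trees on [m+1] equals
-- Dᵐ F at (1, 0) (TreeSums.tree-sum).  The sequences aₘ = Dᵐx, bₘ = Dᵐy
-- (at x = y = 1) satisfy a′ = a b, b′ = a, a(0) = b(0) = 1 by the Leibniz
-- rule of the grammar (Grammar), and this system forces a (1 - sin) = 1,
-- b (1 - sin) = cos (TrigonometricSystem).  Since 2·leaves + unary = n + 1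
-- in a tree on [n], the leaf totals are A₀,ₘ₊₁ = (m+2) aₘ - aₘ₊₁, i.e.
-- A₀ = z a - a + b (LeafSeries); multiplying by 1 - sin z gives the theorem.

open import Data.Nat using (ℕ)

module PowerSeries where
  open import Defs
  open import Data.Nat using (ℕ; zero; suc; _∸_; _≤_; z≤n; s≤s)
  import Data.Nat.Properties as ℕP
  open import Data.Nat.Combinatorics using (_C_; nCk+nC[k+1]≡[n+1]C[k+1]; k>n⇒nCk≡0)
  open import Data.Integer using (ℤ; +_; -_; _+_; _-_; _*_; 0ℤ; 1ℤ)
  import Data.Integer.Properties as ℤP
  open import Algebra.Properties.AbelianGroup ℤP.+-0-abelianGroup using (∙-cancelʳ)
  open import Data.Integer.Tactic.RingSolver using (solve-∀)
  open import Data.Sum using (inj₁; inj₂)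
  open import Relation.Binary.PropositionalEquality
  open ≡-Reasoning

  -- The derivative: n! [zⁿ] f′ = (n+1)! [zⁿ⁺¹] f.
  D : EGF → EGF
  D f n = f (suc n)

  infixl 6 _⊕_ _⊖_
  _⊕_ _⊖_ : EGF → EGF → EGF
  (f ⊕ g) n = f n + g n
  (f ⊖ g) n = f n - g n

  ⊖_ : EGF → EGF
  (⊖ f) n = - f n

  infixl 7 _·_
  _·_ : ℤ → EGF → EGF
  (c · f) n = c * f n

  Σ-cong : ∀ n {f g : ℕ → ℤ} → (∀ k → k ≤ n → f k ≡ g k) → Σ≤ n f ≡ Σ≤ n g
  Σ-cong zero    f≡g = f≡g 0 z≤n
  Σ-cong (suc n) f≡g =
    cong₂ _+_ (Σ-cong n (λ k k≤n → f≡g k (ℕP.m≤n⇒m≤1+n k≤n))) (f≡g (suc n) ℕP.≤-refl)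

  Σ-+ : ∀ n (f g : ℕ → ℤ) → Σ≤ n (λ k → f k + g k) ≡ Σ≤ n f + Σ≤ n g
  Σ-+ zero    f g = refl
  Σ-+ (suc n) f g =
    trans (cong (_+ (f (suc n) + g (suc n))) (Σ-+ n f g))
          (interchange (Σ≤ n f) (Σ≤ n g) (f (suc n)) (g (suc n)))
    where
    interchange : ∀ a b c d → (a + b) + (c + d) ≡ (a + c) + (b + d)
    interchange = solve-∀

  Σ-* : ∀ n c (f : ℕ → ℤ) → Σ≤ n (λ k → c * f k) ≡ c * Σ≤ n f
  Σ-* zero    c f = refl
  Σ-* (suc n) c f =
    trans (cong (_+ (c * f (suc n))) (Σ-* n c f)) (sym (ℤP.*-distribˡ-+ c _ _))

  Σ-shift : ∀ n (f : ℕ → ℤ) → Σ≤ (suc n) f ≡ f 0 + Σ≤ n (λ k → f (suc k))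
  Σ-shift zero    f = refl
  Σ-shift (suc n) f =
    trans (cong (_+ f (suc (suc n))) (Σ-shift n f)) (ℤP.+-assoc (f 0) _ _)

  ⊙-zero : ∀ f g → (f ⊙ g) 0 ≡ f 0 * g 0
  ⊙-zero f g = ℤP.*-identityˡ _

  term : EGF → EGF → ℕ → ℕ → ℤ
  term f g n k = + (n C k) * (f k * g (n ∸ k))

  ⊙-congˡ : ∀ {f f′} → f ≗ f′ → ∀ g → (f ⊙ g) ≗ (f′ ⊙ g)
  ⊙-congˡ f≗f′ g n = Σ-cong n (λ k _ → cong (λ x → + (n C k) * (x * g (n ∸ k))) (f≗f′ k))

  ⊙-congʳ : ∀ f {g g′} → g ≗ g′ → (f ⊙ g) ≗ (f ⊙ g′)
  ⊙-congʳ f g≗g′ n = Σ-cong n (λ k _ → cong (λ y → + (n C k) * (f k * y)) (g≗g′ (n ∸ k)))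

  ⊙-distribˡ : ∀ f g h → (f ⊙ (g ⊕ h)) ≗ (f ⊙ g) ⊕ (f ⊙ h)
  ⊙-distribˡ f g h n = trans (Σ-cong n (λ k _ → expand (+ (n C k)) (f k) (g (n ∸ k)) (h (n ∸ k)))) (Σ-+ n _ _)
    where
    expand : ∀ c x y z → c * (x * (y + z)) ≡ c * (x * y) + c * (x * z)
    expand = solve-∀

  ⊙-distribʳ : ∀ f g h → ((f ⊕ g) ⊙ h) ≗ (f ⊙ h) ⊕ (g ⊙ h)
  ⊙-distribʳ f g h n = trans (Σ-cong n (λ k _ → expand (+ (n C k)) (f k) (g k) (h (n ∸ k)))) (Σ-+ n _ _)
    where
    expand : ∀ c x y z → c * ((x + y) * z) ≡ c * (x * z) + c * (y * z)
    expand = solve-∀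

  ⊙-scaleˡ : ∀ c f g → ((c · f) ⊙ g) ≗ c · (f ⊙ g)
  ⊙-scaleˡ c f g n = trans (Σ-cong n (λ k _ → reorder (+ (n C k)) c (f k) (g (n ∸ k)))) (Σ-* n c _)
    where
    reorder : ∀ b c x y → b * ((c * x) * y) ≡ c * (b * (x * y))
    reorder = solve-∀

  ⊙-scaleʳ : ∀ c f g → (f ⊙ (c · g)) ≗ c · (f ⊙ g)
  ⊙-scaleʳ c f g n = trans (Σ-cong n (λ k _ → reorder (+ (n C k)) c (f k) (g (n ∸ k)))) (Σ-* n c _)
    where
    reorder : ∀ b c x y → b * (x * (c * y)) ≡ c * (b * (x * y))
    reorder = solve-∀

  ⊖≗-1· : ∀ f → (⊖ f) ≗ (- 1ℤ) · f
  ⊖≗-1· f n = sym (ℤP.-1*i≡-i (f n))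

  ⊙-negˡ : ∀ f g → ((⊖ f) ⊙ g) ≗ ⊖ (f ⊙ g)
  ⊙-negˡ f g n = trans (⊙-congˡ (⊖≗-1· f) g n)
                       (trans (⊙-scaleˡ (- 1ℤ) f g n) (ℤP.-1*i≡-i _))

  ⊙-negʳ : ∀ f g → (f ⊙ (⊖ g)) ≗ ⊖ (f ⊙ g)
  ⊙-negʳ f g n = trans (⊙-congʳ f (⊖≗-1· g) n)
                       (trans (⊙-scaleʳ (- 1ℤ) f g n) (ℤP.-1*i≡-i _))

  -- Leibniz rule (f ⊙ g)′ = f′ ⊙ g + f ⊙ g′, from Pascal's rule
  -- C(n+1, k+1) = C(n, k) + C(n, k+1).
  leibniz : ∀ f g n → (f ⊙ g) (suc n) ≡ (D f ⊙ g) n + (f ⊙ D g) n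
  leibniz f g n =
    begin
      (f ⊙ g) (suc n)
    ≡⟨ Σ-shift n (term f g (suc n)) ⟩
      A + Σ≤ n (λ k → term f g (suc n) (suc k))
    ≡⟨ cong (λ x → A + x) (trans (Σ-cong n (λ k _ → pascal k)) (Σ-+ n _ _)) ⟩
      A + ((D f ⊙ g) n + B)
    ≡⟨ rotate A ((D f ⊙ g) n) B ⟩
      (D f ⊙ g) n + (A + B)
    ≡⟨ cong (λ x → (D f ⊙ g) n + x) (sym right) ⟩
      (D f ⊙ g) n + (f ⊙ D g) n
    ∎
    where
    A B : ℤ
    A = term f g (suc n) 0
    B = Σ≤ n (λ k → + (n C suc k) * (f (suc k) * g (n ∸ k)))
    rotate : ∀ a b c → a + (b + c) ≡ b + (a + c)
    rotate = solve-∀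
    pascal : ∀ k → term f g (suc n) (suc k) ≡ term (D f) g n k + + (n C suc k) * (f (suc k) * g (n ∸ k))
    pascal k =
      trans (cong (λ c → + c * (f (suc k) * g (n ∸ k))) (sym (nCk+nC[k+1]≡[n+1]C[k+1] n k)))
     (trans (cong (_* (f (suc k) * g (n ∸ k))) (ℤP.pos-+ (n C k) (n C suc k)))
            (ℤP.*-distribʳ-+ (f (suc k) * g (n ∸ k)) (+ (n C k)) (+ (n C suc k))))
    -- (f ⊙ D g) n, padded by the vanishing term k = n+1, is A + B
    right : (f ⊙ D g) n ≡ A + B
    right =
      begin
        (f ⊙ D g) n
      ≡⟨ Σ-cong n (λ k k≤n → cong (λ x → + (n C k) * (f k * g x)) (sym (ℕP.+-∸-assoc 1 k≤n))) ⟩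
        Σ≤ n h
      ≡⟨ sym (ℤP.+-identityʳ _) ⟩
        Σ≤ n h + 0ℤ
      ≡⟨ cong (λ x → Σ≤ n h + x) (sym vanishing) ⟩
        Σ≤ (suc n) h
      ≡⟨ Σ-shift n h ⟩
        A + B
      ∎
      where
      h : ℕ → ℤ
      h k = + (n C k) * (f k * g (suc n ∸ k))
      vanishing : h (suc n) ≡ 0ℤ
      vanishing = trans (cong (λ c → + c * (f (suc n) * g (n ∸ n))) (k>n⇒nCk≡0 (ℕP.n<1+n n))) (ℤP.*-zeroˡ (f (suc n) * g (n ∸ n)))

  -- ⊙ is commutative and associative with unit oneEGF; each law follows
  -- coefficientwise by induction, using the Leibniz rule.
  ⊙-comm : ∀ f g → (f ⊙ g) ≗ (g ⊙ f)
  ⊙-comm f g zero    = trans (⊙-zero f g) (trans (ℤP.*-comm (f 0) (g 0)) (sym (⊙-zero g f)))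
  ⊙-comm f g (suc n) =
    begin
      (f ⊙ g) (suc n)
    ≡⟨ leibniz f g n ⟩
      (D f ⊙ g) n + (f ⊙ D g) n
    ≡⟨ cong₂ _+_ (⊙-comm (D f) g n) (⊙-comm f (D g) n) ⟩
      (g ⊙ D f) n + (D g ⊙ f) n
    ≡⟨ ℤP.+-comm ((g ⊙ D f) n) ((D g ⊙ f) n) ⟩
      (D g ⊙ f) n + (g ⊙ D f) n
    ≡⟨ sym (leibniz g f n) ⟩
      (g ⊙ f) (suc n)
    ∎

  ⊙-assoc : ∀ f g h → ((f ⊙ g) ⊙ h) ≗ (f ⊙ (g ⊙ h))
  ⊙-assoc f g h zero =
    begin
      ((f ⊙ g) ⊙ h) 0
    ≡⟨ trans (⊙-zero (f ⊙ g) h) (cong (_* h 0) (⊙-zero f g)) ⟩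
      (f 0 * g 0) * h 0
    ≡⟨ ℤP.*-assoc (f 0) (g 0) (h 0) ⟩
      f 0 * (g 0 * h 0)
    ≡⟨ sym (trans (⊙-zero f (g ⊙ h)) (cong (f 0 *_) (⊙-zero g h))) ⟩
      (f ⊙ (g ⊙ h)) 0
    ∎
  ⊙-assoc f g h (suc n) =
    begin
      ((f ⊙ g) ⊙ h) (suc n)
    ≡⟨ leibniz (f ⊙ g) h n ⟩
      (D (f ⊙ g) ⊙ h) n + ((f ⊙ g) ⊙ D h) n
    ≡⟨ cong (_+ ((f ⊙ g) ⊙ D h) n)
         (trans (⊙-congˡ (leibniz f g) h n) (⊙-distribʳ (D f ⊙ g) (f ⊙ D g) h n)) ⟩
      (((D f ⊙ g) ⊙ h) n + ((f ⊙ D g) ⊙ h) n) + ((f ⊙ g) ⊙ D h) n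
    ≡⟨ cong₂ _+_ (cong₂ _+_ (⊙-assoc (D f) g h n) (⊙-assoc f (D g) h n)) (⊙-assoc f g (D h) n) ⟩
      ((D f ⊙ (g ⊙ h)) n + (f ⊙ (D g ⊙ h)) n) + (f ⊙ (g ⊙ D h)) n
    ≡⟨ ℤP.+-assoc ((D f ⊙ (g ⊙ h)) n) _ _ ⟩
      (D f ⊙ (g ⊙ h)) n + ((f ⊙ (D g ⊙ h)) n + (f ⊙ (g ⊙ D h)) n)
    ≡⟨ cong (λ x → (D f ⊙ (g ⊙ h)) n + x)
         (sym (trans (⊙-congʳ f (leibniz g h) n) (⊙-distribˡ f (D g ⊙ h) (g ⊙ D h) n))) ⟩
      (D f ⊙ (g ⊙ h)) n + (f ⊙ D (g ⊙ h)) n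
    ≡⟨ sym (leibniz f (g ⊙ h) n) ⟩
      (f ⊙ (g ⊙ h)) (suc n)
    ∎

  ⊙-zeroʳ : ∀ f → (f ⊙ (λ _ → 0ℤ)) ≗ (λ _ → 0ℤ)
  ⊙-zeroʳ f n =
    trans (Σ-cong n (λ k _ → trans (cong (+ (n C k) *_) (ℤP.*-zeroʳ (f k))) (ℤP.*-zeroʳ (+ (n C k)))))
          (Σ-* n 0ℤ (λ _ → 0ℤ))

  ⊙-identityʳ : ∀ f → (f ⊙ oneEGF) ≗ f
  ⊙-identityʳ f zero    = trans (⊙-zero f oneEGF) (ℤP.*-identityʳ (f 0))
  ⊙-identityʳ f (suc n) =
    trans (leibniz f oneEGF n)
          (trans (cong₂ _+_ (⊙-identityʳ (D f) n) (⊙-zeroʳ f n)) (ℤP.+-identityʳ (f (suc n))))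

  ⊙-identityˡ : ∀ f → (oneEGF ⊙ f) ≗ f
  ⊙-identityˡ f n = trans (⊙-comm oneEGF f n) (⊙-identityʳ f n)

  ⊙-distribʳ-⊖ : ∀ f g h → ((f ⊖ g) ⊙ h) ≗ (f ⊙ h) ⊖ (g ⊙ h)
  ⊙-distribʳ-⊖ f g h n = trans (⊙-distribʳ f (⊖ g) h n) (cong (λ x → (f ⊙ h) n + x) (⊙-negˡ g h n))

  z⊙-suc : ∀ f m → (zEGF ⊙ f) (suc m) ≡ + suc m * f m
  z⊙-suc f m = trans (leibniz zEGF f m) (trans (cong (_+ (zEGF ⊙ D f) m) (⊙-identityˡ f m)) (shifted m))
    where
    shifted : ∀ m → f m + (zEGF ⊙ D f) m ≡ + suc m * f m
    shifted zero    = trans (ℤP.+-identityʳ (f 0)) (sym (ℤP.*-identityˡ (f 0)))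
    shifted (suc m) =
      trans (cong (λ x → f (suc m) + x) (z⊙-suc (D f) m))
     (trans (gather (+ suc m) (f (suc m))) (cong (_* f (suc m)) (sym (ℤP.pos-+ 1 (suc m)))))
      where
      gather : ∀ c x → x + c * x ≡ (+ 1 + c) * x
      gather = solve-∀

  -- Agreement up to order n, i.e. equality modulo z^(n+1).  Coefficient n
  -- of a product only involves coefficients of order ≤ n of the factors.
  infix 4 _≈[_]_
  _≈[_]_ : EGF → ℕ → EGF → Set
  f ≈[ n ] g = ∀ k → k ≤ n → f k ≡ g k

  ≈-extend : ∀ {f g} n → f ≈[ n ] g → f (suc n) ≡ g (suc n) → f ≈[ suc n ] g
  ≈-extend n f≈g eq k k≤1+n with ℕP.m≤n⇒m<n∨m≡n k≤1+n
  ... | inj₁ (s≤s k≤n) = f≈g k k≤n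
  ... | inj₂ refl      = eq

  ≈-restrict : ∀ {f g m n} → m ≤ n → f ≈[ n ] g → f ≈[ m ] g
  ≈-restrict m≤n f≈g k k≤m = f≈g k (ℕP.≤-trans k≤m m≤n)

  ⊙-congˡ-≈ : ∀ {f f′} n → f ≈[ n ] f′ → ∀ g → (f ⊙ g) ≈[ n ] (f′ ⊙ g)
  ⊙-congˡ-≈ n f≈f′ g k k≤n =
    Σ-cong k (λ j j≤k → cong (λ x → + (k C j) * (x * g (k ∸ j))) (f≈f′ j (ℕP.≤-trans j≤k k≤n)))

  ⊙-congʳ-≈ : ∀ f {g g′} n → g ≈[ n ] g′ → (f ⊙ g) ≈[ n ] (f ⊙ g′)
  ⊙-congʳ-≈ f n g≈g′ k k≤n =
    Σ-cong k (λ j _ → cong (λ y → + (k C j) * (f j * y)) (g≈g′ (k ∸ j) (ℕP.≤-trans (ℕP.m∸n≤m k j) k≤n)))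

  ⊙-split : ∀ f g n → (f ⊙ g) (suc n) ≡ f 0 * g (suc n) + Σ≤ n (λ k → term f g (suc n) (suc k))
  ⊙-split f g n = trans (Σ-shift n (term f g (suc n)))
          (cong (λ x → x + Σ≤ n (λ k → term f g (suc n) (suc k))) (ℤP.*-identityˡ (f 0 * g (suc n))))

  -- A series u with constant term 1 is cancellable, even up to order n:
  -- (u ⊙ x)(n) = x(n) + (terms involving only x(0), …, x(n-1)).
  ⊙-cancelˡ-≈ : ∀ u {x y} n → u 0 ≡ 1ℤ → (u ⊙ x) ≈[ n ] (u ⊙ y) → x ≈[ n ] y
  ⊙-cancelˡ-≈ u {x} {y} zero u0≡1 ux≈uy .0 z≤n =
    begin
      x 0               ≡⟨ sym (leading x) ⟩
      u 0 * x 0         ≡⟨ sym (⊙-zero u x) ⟩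
      (u ⊙ x) 0         ≡⟨ ux≈uy 0 z≤n ⟩
      (u ⊙ y) 0         ≡⟨ ⊙-zero u y ⟩
      u 0 * y 0         ≡⟨ leading y ⟩
      y 0
    ∎
    where
    leading : ∀ z → u 0 * z 0 ≡ z 0
    leading z = trans (cong (_* z 0) u0≡1) (ℤP.*-identityˡ (z 0))
  ⊙-cancelˡ-≈ u {x} {y} (suc n) u0≡1 ux≈uy = ≈-extend n x≈y top
    where
    x≈y : x ≈[ n ] y
    x≈y = ⊙-cancelˡ-≈ u n u0≡1 (≈-restrict (ℕP.n≤1+n n) ux≈uy)
    rest : ∀ z → ℤ
    rest z = Σ≤ n (λ k → term u z (suc n) (suc k))
    same-rest : rest x ≡ rest y
    same-rest = Σ-cong n (λ k _ → cong (λ v → + (suc n C suc k) * (u (suc k) * v))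
                                       (x≈y (n ∸ k) (ℕP.m∸n≤m n k)))
    leading : ∀ z → (u ⊙ z) (suc n) ≡ z (suc n) + rest z
    leading z = trans (⊙-split u z n)
                      (cong (_+ rest z) (trans (cong (_* z (suc n)) u0≡1) (ℤP.*-identityˡ (z (suc n)))))
    top : x (suc n) ≡ y (suc n)
    top = ∙-cancelʳ (rest x) (x (suc n)) (y (suc n))
            (trans (sym (leading x))
            (trans (ux≈uy (suc n) ℕP.≤-refl)
            (trans (leading y) (cong (λ r → y (suc n) + r) (sym same-rest)))))

module Trigonometric where
  open import Defs
  open PowerSeries
  open import Data.Nat as ℕ using (ℕ; zero; suc; _%_)
  open import Data.Integer using (ℤ; +_; -_; _+_; 0ℤ)
  import Data.Integer.Properties as ℤP
  open import Data.Integer.Tactic.RingSolver using (solve-∀)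
  open import Relation.Binary.PropositionalEquality
  open ≡-Reasoning

  -- sin and cos as functions of the residue mod 4; the residue of 4 + n
  -- reduces definitionally to that of n, which gives periodicity.
  sinRes cosRes : ℕ → ℤ
  sinRes 1 = + 1
  sinRes 3 = - + 1
  sinRes _ = 0ℤ
  cosRes 0 = + 1
  cosRes 2 = - + 1
  cosRes _ = 0ℤ

  sin≡sinRes : ∀ n → sinEGF n ≡ sinRes (n % 4)
  sin≡sinRes n with n % 4
  ... | 0 = refl
  ... | 1 = refl
  ... | 2 = refl
  ... | 3 = refl
  ... | suc (suc (suc (suc _))) = refl

  cos≡cosRes : ∀ n → cosEGF n ≡ cosRes (n % 4)
  cos≡cosRes n with n % 4
  ... | 0 = refl
  ... | 1 = refl
  ... | 2 = refl
  ... | 3 = refl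
  ... | suc (suc (suc (suc _))) = refl

  sin-periodic : ∀ n → sinEGF (4 ℕ.+ n) ≡ sinEGF n
  sin-periodic n = trans (sin≡sinRes (4 ℕ.+ n)) (sym (sin≡sinRes n))

  cos-periodic : ∀ n → cosEGF (4 ℕ.+ n) ≡ cosEGF n
  cos-periodic n = trans (cos≡cosRes (4 ℕ.+ n)) (sym (cos≡cosRes n))

  D-sin : D sinEGF ≗ cosEGF
  D-sin 0 = refl
  D-sin 1 = refl
  D-sin 2 = refl
  D-sin 3 = refl
  D-sin (suc (suc (suc (suc n)))) =
    trans (sin-periodic (suc n)) (trans (D-sin n) (sym (cos-periodic n)))

  D-cos : D cosEGF ≗ ⊖ sinEGF
  D-cos 0 = refl
  D-cos 1 = refl
  D-cos 2 = refl
  D-cos 3 = refl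
  D-cos (suc (suc (suc (suc n)))) =
    trans (cos-periodic (suc n)) (trans (D-cos n) (cong -_ (sym (sin-periodic n))))

  -- sin² + cos² = 1: the left side has derivative 0 and constant term 1.
  pythagoras : (sinEGF ⊙ sinEGF) ⊕ (cosEGF ⊙ cosEGF) ≗ oneEGF
  pythagoras zero    = refl
  pythagoras (suc n) =
    begin
      (sinEGF ⊙ sinEGF) (suc n) + (cosEGF ⊙ cosEGF) (suc n)
    ≡⟨ cong₂ _+_ (leibniz sinEGF sinEGF n) (leibniz cosEGF cosEGF n) ⟩
      ((D sinEGF ⊙ sinEGF) n + (sinEGF ⊙ D sinEGF) n) + ((D cosEGF ⊙ cosEGF) n + (cosEGF ⊙ D cosEGF) n)
    ≡⟨ cong₂ _+_ (cong₂ _+_ (⊙-congˡ D-sin sinEGF n) (⊙-congʳ sinEGF D-sin n))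
                 (cong₂ _+_ (trans (⊙-congˡ D-cos cosEGF n) (⊙-negˡ sinEGF cosEGF n))
                            (trans (⊙-congʳ cosEGF D-cos n) (⊙-negʳ cosEGF sinEGF n))) ⟩
      (cs + sc) + (- sc + - cs)
    ≡⟨ cancel cs sc ⟩
      0ℤ
    ∎
    where
    cs sc : ℤ
    cs = (cosEGF ⊙ sinEGF) n
    sc = (sinEGF ⊙ cosEGF) n
    cancel : ∀ x y → (x + y) + (- y + - x) ≡ 0ℤ
    cancel = solve-∀

  one-sin : EGF
  one-sin = oneEGF ⊖ sinEGF

  D-one-sin : D one-sin ≗ ⊖ cosEGF
  D-one-sin n = trans (ℤP.+-identityˡ (- sinEGF (suc n))) (cong -_ (D-sin n))

  one-sin⊙one+sin : (one-sin ⊙ (oneEGF ⊕ sinEGF)) ≗ (cosEGF ⊙ cosEGF)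
  one-sin⊙one+sin n =
    begin
      (one-sin ⊙ (oneEGF ⊕ sinEGF)) n
    ≡⟨ ⊙-distribʳ oneEGF (⊖ sinEGF) (oneEGF ⊕ sinEGF) n ⟩
      (oneEGF ⊙ (oneEGF ⊕ sinEGF)) n + ((⊖ sinEGF) ⊙ (oneEGF ⊕ sinEGF)) n
    ≡⟨ cong₂ _+_ (⊙-identityˡ (oneEGF ⊕ sinEGF) n)
                 (trans (⊙-negˡ sinEGF (oneEGF ⊕ sinEGF) n)
                        (cong -_ (trans (⊙-distribˡ sinEGF oneEGF sinEGF n)
                                        (cong (_+ (sinEGF ⊙ sinEGF) n) (⊙-identityʳ sinEGF n))))) ⟩
      (oneEGF n + sinEGF n) + - (sinEGF n + (sinEGF ⊙ sinEGF) n)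
    ≡⟨ cong (λ o → (o + sinEGF n) + - (sinEGF n + (sinEGF ⊙ sinEGF) n)) (sym (pythagoras n)) ⟩
      ((sinEGF ⊙ sinEGF) n + (cosEGF ⊙ cosEGF) n + sinEGF n) + - (sinEGF n + (sinEGF ⊙ sinEGF) n)
    ≡⟨ simplify ((sinEGF ⊙ sinEGF) n) ((cosEGF ⊙ cosEGF) n) (sinEGF n) ⟩
      (cosEGF ⊙ cosEGF) n
    ∎
    where
    simplify : ∀ ss cc s → (ss + cc + s) + - (s + ss) ≡ cc
    simplify = solve-∀

module TrigonometricSystem where
  open import Defs
  open PowerSeries
  open Trigonometric
  open import Data.Nat using (zero; suc; z≤n)
  import Data.Nat.Properties as ℕP
  open import Data.Integer using (-_; _+_; 0ℤ; 1ℤ)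
  import Data.Integer.Properties as ℤP
  open import Data.Integer.Tactic.RingSolver using (solve-∀)
  open import Data.Product using (_×_; _,_; proj₁; proj₂)
  open import Relation.Binary.PropositionalEquality
  open ≡-Reasoning

  module _ (a b : EGF) (D-a : D a ≗ a ⊙ b) (D-b : D b ≗ a) (a0 : a 0 ≡ 1ℤ) (b0 : b 0 ≡ 1ℤ) where

    -- Once b (1 - sin) = cos is known up to order n, so is b cos = 1 + sin:
    -- multiplied by 1 - sin both sides become cos², and 1 - sin cancels.
    b⊙cos≈one+sin : ∀ n → (b ⊙ one-sin) ≈[ n ] cosEGF → (b ⊙ cosEGF) ≈[ n ] (oneEGF ⊕ sinEGF)
    b⊙cos≈one+sin n bu≈cos = ⊙-cancelˡ-≈ one-sin n refl multiplied
      where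
      multiplied : (one-sin ⊙ (b ⊙ cosEGF)) ≈[ n ] (one-sin ⊙ (oneEGF ⊕ sinEGF))
      multiplied k k≤n =
        begin
          (one-sin ⊙ (b ⊙ cosEGF)) k
        ≡⟨ sym (⊙-assoc one-sin b cosEGF k) ⟩
          ((one-sin ⊙ b) ⊙ cosEGF) k
        ≡⟨ ⊙-congˡ (⊙-comm one-sin b) cosEGF k ⟩
          ((b ⊙ one-sin) ⊙ cosEGF) k
        ≡⟨ ⊙-congˡ-≈ n bu≈cos cosEGF k k≤n ⟩
          (cosEGF ⊙ cosEGF) k
        ≡⟨ sym (one-sin⊙one+sin k) ⟩
          (one-sin ⊙ (oneEGF ⊕ sinEGF)) k
        ∎

    -- (a (1 - sin))′ = a (b (1 - sin)) - a cos
    a⊙one-sin-step : ∀ n → (b ⊙ one-sin) ≈[ n ] cosEGF → (a ⊙ one-sin) (suc n) ≡ oneEGF (suc n)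
    a⊙one-sin-step n bu≈cos =
      begin
        (a ⊙ one-sin) (suc n)
      ≡⟨ leibniz a one-sin n ⟩
        (D a ⊙ one-sin) n + (a ⊙ D one-sin) n
      ≡⟨ cong₂ _+_ (trans (⊙-congˡ D-a one-sin n) (⊙-assoc a b one-sin n))
                   (trans (⊙-congʳ a D-one-sin n) (⊙-negʳ a cosEGF n)) ⟩
        (a ⊙ (b ⊙ one-sin)) n + - (a ⊙ cosEGF) n
      ≡⟨ cong (_+ - (a ⊙ cosEGF) n) (⊙-congʳ-≈ a n bu≈cos n ℕP.≤-refl) ⟩
        (a ⊙ cosEGF) n + - (a ⊙ cosEGF) n
      ≡⟨ ℤP.+-inverseʳ ((a ⊙ cosEGF) n) ⟩
        0ℤ
      ∎

    -- (b (1 - sin))′ = a (1 - sin) - b cos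
    b⊙one-sin-step : ∀ n → (a ⊙ one-sin) n ≡ oneEGF n → (b ⊙ one-sin) ≈[ n ] cosEGF →
                     (b ⊙ one-sin) (suc n) ≡ cosEGF (suc n)
    b⊙one-sin-step n au≡1 bu≈cos =
      begin
        (b ⊙ one-sin) (suc n)
      ≡⟨ leibniz b one-sin n ⟩
        (D b ⊙ one-sin) n + (b ⊙ D one-sin) n
      ≡⟨ cong₂ _+_ (trans (⊙-congˡ D-b one-sin n) au≡1)
                   (trans (⊙-congʳ b D-one-sin n) (⊙-negʳ b cosEGF n)) ⟩
        oneEGF n + - (b ⊙ cosEGF) n
      ≡⟨ cong (λ w → oneEGF n + - w) (b⊙cos≈one+sin n bu≈cos n ℕP.≤-refl) ⟩
        oneEGF n + - (oneEGF n + sinEGF n)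
      ≡⟨ simplify (oneEGF n) (sinEGF n) ⟩
        - sinEGF n
      ≡⟨ sym (D-cos n) ⟩
        cosEGF (suc n)
      ∎
      where
      simplify : ∀ x y → x + - (x + y) ≡ - y
      simplify = solve-∀

    identities≈ : ∀ n → (a ⊙ one-sin) ≈[ n ] oneEGF × (b ⊙ one-sin) ≈[ n ] cosEGF
    identities≈ zero = (λ { _ z≤n → trans (constant-term a) a0 }) , (λ { _ z≤n → trans (constant-term b) b0 })
      where
      constant-term : ∀ f → (f ⊙ one-sin) 0 ≡ f 0
      constant-term f = trans (⊙-zero f one-sin) (ℤP.*-identityʳ (f 0))
    identities≈ (suc n) with identities≈ n
    ... | au≈1 , bu≈cos =
      ≈-extend n au≈1 (a⊙one-sin-step n bu≈cos) ,
      ≈-extend n bu≈cos (b⊙one-sin-step n (au≈1 n ℕP.≤-refl) bu≈cos)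

    a⊙one-sin≗one : (a ⊙ one-sin) ≗ oneEGF
    a⊙one-sin≗one n = proj₁ (identities≈ n) n ℕP.≤-refl

    b⊙one-sin≗cos : (b ⊙ one-sin) ≗ cosEGF
    b⊙one-sin≗cos n = proj₂ (identities≈ n) n ℕP.≤-refl

-- Its derivation acts on monomials by
--   D(xⁱ yʲ) = i xⁱ yʲ⁺¹ + j xⁱ⁺¹ yʲ⁻¹,
-- and dually on weights F(i, j) of states (i leaves, j unary vertices) by
-- the growth operator below.  The sequences Dᵐ(xⁱ yʲ) at x = y = 1 obey a
-- Leibniz rule, which yields the differential system a′ = a b, b′ = a.
module Grammar where
  open import Defs
  open PowerSeries
  open import Data.Nat as ℕ using (ℕ; zero; suc; _∸_)
  import Data.Nat.Properties as ℕP
  open import Data.Integer using (ℤ; +_; _+_; _*_)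
  import Data.Integer.Properties as ℤP
  open import Data.Integer.Tactic.RingSolver using (solve-∀)
  import Data.Nat.Tactic.RingSolver as NatSolver
  open import Relation.Binary.PropositionalEquality
  open ≡-Reasoning

  -- weights of states (number of leaves, number of unary vertices)
  Weight : Set
  Weight = ℕ → ℕ → ℕ

  -- attach a new leaf below one of the i leaves or the j unary vertices
  grow : Weight → Weight
  grow F i j = i ℕ.* F i (suc j) ℕ.+ j ℕ.* F (suc i) (j ∸ 1)

  grow^ : ℕ → Weight → Weight
  grow^ zero    F = F
  grow^ (suc k) F = grow^ k (grow F)

  grow^-suc : ∀ k F → grow^ (suc k) F ≡ grow (grow^ k F)
  grow^-suc zero    F = refl
  grow^-suc (suc k) F = grow^-suc k (grow F)

  grow^-cong : ∀ k {F G : Weight} → (∀ i j → F i j ≡ G i j) → ∀ i j → grow^ k F i j ≡ grow^ k G i j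
  grow^-cong zero    F≗G = F≗G
  grow^-cong (suc k) F≗G = grow^-cong k (λ i j → cong₂ (λ x y → i ℕ.* x ℕ.+ j ℕ.* y) (F≗G i (suc j)) (F≗G (suc i) (j ∸ 1)))

  grow^-+ : ∀ k (F G : Weight) i j → grow^ k (λ i j → F i j ℕ.+ G i j) i j ≡ grow^ k F i j ℕ.+ grow^ k G i j
  grow^-+ zero    F G i j = refl
  grow^-+ (suc k) F G i j =
    trans (grow^-cong k (λ i j → distribute i j (F i (suc j)) (G i (suc j)) (F (suc i) (j ∸ 1)) (G (suc i) (j ∸ 1))) i j)
          (grow^-+ k (grow F) (grow G) i j)
    where
    distribute : ∀ i j x y z w → i ℕ.* (x ℕ.+ y) ℕ.+ j ℕ.* (z ℕ.+ w) ≡ (i ℕ.* x ℕ.+ j ℕ.* z) ℕ.+ (i ℕ.* y ℕ.+ j ℕ.* w)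
    distribute = NatSolver.solve-∀

  -- Each growth step raises 2 · leaves + unary by one, so weighting by
  -- c + 2i + j commutes with grow up to the shift c ↦ c + 1.
  weighted : ℕ → Weight → Weight
  weighted c F i j = (c ℕ.+ (i ℕ.+ i ℕ.+ j)) ℕ.* F i j

  grow-weighted : ∀ c F i j → grow (weighted c F) i j ≡ weighted (suc c) (grow F) i j
  grow-weighted c F i zero    = shift₀ c i (F i 1)
    where
    shift₀ : ∀ c i x → i ℕ.* ((c ℕ.+ (i ℕ.+ i ℕ.+ 1)) ℕ.* x) ℕ.+ 0 ≡ (suc c ℕ.+ (i ℕ.+ i ℕ.+ 0)) ℕ.* (i ℕ.* x ℕ.+ 0)
    shift₀ = NatSolver.solve-∀
  grow-weighted c F i (suc j) = shift c i j (F i (suc (suc j))) (F (suc i) j)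
    where
    shift : ∀ c i j x y →
      i ℕ.* ((c ℕ.+ (i ℕ.+ i ℕ.+ suc (suc j))) ℕ.* x) ℕ.+ suc j ℕ.* ((c ℕ.+ (suc i ℕ.+ suc i ℕ.+ j)) ℕ.* y)
      ≡ (suc c ℕ.+ (i ℕ.+ i ℕ.+ suc j)) ℕ.* (i ℕ.* x ℕ.+ suc j ℕ.* y)
    shift = NatSolver.solve-∀

  grow^-weighted : ∀ k c F i j → grow^ k (weighted c F) i j ≡ weighted (k ℕ.+ c) (grow^ k F) i j
  grow^-weighted zero    c F i j = refl
  grow^-weighted (suc k) c F i j =
    trans (grow^-cong k (grow-weighted c F) i j)
   (trans (grow^-weighted k (suc c) (grow F) i j)
          (cong (λ c′ → weighted c′ (grow^ k (grow F)) i j) (ℕP.+-suc k c)))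

  one : Weight
  one _ _ = 1

  -- m ↦ Dᵐ(xⁱ yʲ) evaluated at x = y = 1
  monomial : ℕ → ℕ → EGF
  monomial i j m = + grow^ m one i j

  D-monomial : ∀ i j → D (monomial i j) ≗ (+ i · monomial i (suc j)) ⊕ (+ j · monomial (suc i) (j ∸ 1))
  D-monomial i j m =
    begin
      + grow^ (suc m) one i j
    ≡⟨ cong (λ G → + G i j) (grow^-suc m one) ⟩
      + (i ℕ.* grow^ m one i (suc j) ℕ.+ j ℕ.* grow^ m one (suc i) (j ∸ 1))
    ≡⟨ ℤP.pos-+ (i ℕ.* _) (j ℕ.* _) ⟩
      + (i ℕ.* grow^ m one i (suc j)) + + (j ℕ.* grow^ m one (suc i) (j ∸ 1))
    ≡⟨ cong₂ _+_ (ℤP.pos-* i _) (ℤP.pos-* j _) ⟩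
      + i * monomial i (suc j) m + + j * monomial (suc i) (j ∸ 1) m
    ∎

  -- a term j · G(j - 1 + j′) only matters for j ≥ 1, where j - 1 + j′ = j + j′ - 1
  pred-left : ∀ j j′ (G : ℕ → ℤ) → + j * G ((j ∸ 1) ℕ.+ j′) ≡ + j * G ((j ℕ.+ j′) ∸ 1)
  pred-left zero    j′ G = refl
  pred-left (suc j) j′ G = refl

  pred-right : ∀ j j′ (G : ℕ → ℤ) → + j′ * G (j ℕ.+ (j′ ∸ 1)) ≡ + j′ * G ((j ℕ.+ j′) ∸ 1)
  pred-right j zero     G = refl
  pred-right j (suc j′) G = cong (λ x → + suc j′ * G (x ∸ 1)) (sym (ℕP.+-suc j j′))

  monomial-product : ∀ i j i′ j′ → monomial (i ℕ.+ i′) (j ℕ.+ j′) ≗ (monomial i j ⊙ monomial i′ j′)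
  monomial-product i j i′ j′ zero    = refl
  monomial-product i j i′ j′ (suc m) =
    begin
      D (monomial (i ℕ.+ i′) (j ℕ.+ j′)) m
    ≡⟨ D-monomial (i ℕ.+ i′) (j ℕ.+ j′) m ⟩
      + (i ℕ.+ i′) * X + + (j ℕ.+ j′) * Y
    ≡⟨ cong₂ (λ p q → p * X + q * Y) (ℤP.pos-+ i i′) (ℤP.pos-+ j j′) ⟩
      (+ i + + i′) * X + (+ j + + j′) * Y
    ≡⟨ regroup (+ i) (+ i′) (+ j) (+ j′) X Y ⟩
      (+ i * X + + j * Y) + (+ i′ * X + + j′ * Y)
    ≡⟨ cong₂ _+_ left-half right-half ⟩
      (D m₁ ⊙ m₂) m + (m₁ ⊙ D m₂) m
    ≡⟨ sym (leibniz m₁ m₂ m) ⟩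
      (m₁ ⊙ m₂) (suc m)
    ∎
    where
    m₁ m₂ : EGF
    m₁ = monomial i j
    m₂ = monomial i′ j′
    X Y : ℤ
    X = monomial (i ℕ.+ i′) (suc (j ℕ.+ j′)) m
    Y = monomial (suc (i ℕ.+ i′)) ((j ℕ.+ j′) ∸ 1) m
    regroup : ∀ i i′ j j′ x y → (i + i′) * x + (j + j′) * y ≡ (i * x + j * y) + (i′ * x + j′ * y)
    regroup = solve-∀
    left-half : + i * X + + j * Y ≡ (D m₁ ⊙ m₂) m
    left-half =
      begin
        + i * X + + j * Y
      ≡⟨ cong (λ y → + i * X + y) (sym (pred-left j j′ (λ k → monomial (suc i ℕ.+ i′) k m))) ⟩
        + i * monomial (i ℕ.+ i′) (suc j ℕ.+ j′) m + + j * monomial (suc i ℕ.+ i′) ((j ∸ 1) ℕ.+ j′) m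
      ≡⟨ cong₂ (λ x y → + i * x + + j * y) (monomial-product i (suc j) i′ j′ m)
                                          (monomial-product (suc i) (j ∸ 1) i′ j′ m) ⟩
        + i * (monomial i (suc j) ⊙ m₂) m + + j * (monomial (suc i) (j ∸ 1) ⊙ m₂) m
      ≡⟨ sym (cong₂ _+_ (⊙-scaleˡ (+ i) (monomial i (suc j)) m₂ m)
                        (⊙-scaleˡ (+ j) (monomial (suc i) (j ∸ 1)) m₂ m)) ⟩
        ((+ i · monomial i (suc j)) ⊙ m₂) m + ((+ j · monomial (suc i) (j ∸ 1)) ⊙ m₂) m
      ≡⟨ sym (⊙-distribʳ (+ i · monomial i (suc j)) (+ j · monomial (suc i) (j ∸ 1)) m₂ m) ⟩
        (((+ i · monomial i (suc j)) ⊕ (+ j · monomial (suc i) (j ∸ 1))) ⊙ m₂) m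
      ≡⟨ sym (⊙-congˡ (D-monomial i j) m₂ m) ⟩
        (D m₁ ⊙ m₂) m
      ∎
    right-half : + i′ * X + + j′ * Y ≡ (m₁ ⊙ D m₂) m
    right-half =
      begin
        + i′ * X + + j′ * Y
      ≡⟨ cong₂ (λ x y → + i′ * x + y)
               (cong (λ k → monomial (i ℕ.+ i′) k m) (sym (ℕP.+-suc j j′)))
               (trans (cong (λ k → + j′ * monomial k ((j ℕ.+ j′) ∸ 1) m) (sym (ℕP.+-suc i i′)))
                      (sym (pred-right j j′ (λ k → monomial (i ℕ.+ suc i′) k m)))) ⟩
        + i′ * monomial (i ℕ.+ i′) (j ℕ.+ suc j′) m + + j′ * monomial (i ℕ.+ suc i′) (j ℕ.+ (j′ ∸ 1)) m
      ≡⟨ cong₂ (λ x y → + i′ * x + + j′ * y) (monomial-product i j i′ (suc j′) m)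
                                            (monomial-product i j (suc i′) (j′ ∸ 1) m) ⟩
        + i′ * (m₁ ⊙ monomial i′ (suc j′)) m + + j′ * (m₁ ⊙ monomial (suc i′) (j′ ∸ 1)) m
      ≡⟨ sym (cong₂ _+_ (⊙-scaleʳ (+ i′) m₁ (monomial i′ (suc j′)) m)
                        (⊙-scaleʳ (+ j′) m₁ (monomial (suc i′) (j′ ∸ 1)) m)) ⟩
        (m₁ ⊙ (+ i′ · monomial i′ (suc j′))) m + (m₁ ⊙ (+ j′ · monomial (suc i′) (j′ ∸ 1))) m
      ≡⟨ sym (⊙-distribˡ m₁ (+ i′ · monomial i′ (suc j′)) (+ j′ · monomial (suc i′) (j′ ∸ 1)) m) ⟩
        (m₁ ⊙ ((+ i′ · monomial i′ (suc j′)) ⊕ (+ j′ · monomial (suc i′) (j′ ∸ 1)))) m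
      ≡⟨ sym (⊙-congʳ m₁ (D-monomial i′ j′) m) ⟩
        (m₁ ⊙ D m₂) m
      ∎

  -- aₘ = Dᵐ(x) and bₘ = Dᵐ(y) at x = y = 1; by the grammar a′ = a b, b′ = a.
  aSeq bSeq : EGF
  aSeq = monomial 1 0
  bSeq = monomial 0 1

  D-aSeq : D aSeq ≗ aSeq ⊙ bSeq
  D-aSeq m = trans (D-monomial 1 0 m)
                   (trans (ℤP.+-identityʳ (+ 1 * monomial 1 1 m))
                          (trans (ℤP.*-identityˡ (monomial 1 1 m)) (monomial-product 1 0 0 1 m)))

  D-bSeq : D bSeq ≗ aSeq
  D-bSeq m = trans (D-monomial 0 1 m) (trans (ℤP.+-identityˡ (+ 1 * aSeq m)) (ℤP.*-identityˡ (aSeq m)))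

module Ranges where
  open import Defs
  open import Data.Nat
  open import Data.Nat.Properties
  open import Data.List using ([]; _∷_; map; applyUpTo)
  open import Data.List.Membership.Propositional using (_∈_)
  open import Data.List.Membership.Propositional.Properties using (∈-map⁺; ∈-map⁻; ∈-upTo⁺; ∈-upTo⁻)
  open import Data.List.Relation.Unary.Unique.Propositional using (Unique)
  import Data.List.Relation.Unary.Unique.Propositional.Properties as Unique
  open import Data.Product using (_×_; _,_)
  open import Relation.Binary.PropositionalEquality

  range-empty : ∀ b → range (suc b) b ≡ []
  range-empty b rewrite n∸n≡0 b = refl

  range-cons : ∀ {a b} → a ≤ b → range a b ≡ a ∷ range (suc a) b
  range-cons {a} {b} a≤b rewrite +-∸-assoc 1 a≤b =
    cong₂ _∷_ (+-identityʳ a) (shift (b ∸ a) (λ x → x))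
    where
    shift : ∀ k (h : ℕ → ℕ) →
            map (λ j → a + j) (applyUpTo (λ x → suc (h x)) k) ≡ map (λ j → suc a + j) (applyUpTo h k)
    shift zero    h = refl
    shift (suc k) h = cong₂ _∷_ (+-suc a (h 0)) (shift k (λ x → h (suc x)))

  range-unique : ∀ a b → Unique (range a b)
  range-unique a b = Unique.map⁺ (λ {x} {y} → +-cancelˡ-≡ a x y) (Unique.upTo⁺ (suc b ∸ a))

  ∈-range⁻ : ∀ {a b p} → p ∈ range a b → a ≤ p × p ≤ b
  ∈-range⁻ {a} {b} p∈ with ∈-map⁻ (λ j → a + j) p∈
  ... | j , j∈ , refl = m≤m+n a j , s≤s⁻¹ (begin-strict
      a + j              <⟨ +-monoʳ-< a j<1+b∸a ⟩
      a + (suc b ∸ a)    ≡⟨ m+[n∸m]≡n (<⇒≤ a<1+b) ⟩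
      suc b              ∎)
    where
    open ≤-Reasoning
    j<1+b∸a : j < suc b ∸ a
    j<1+b∸a = ∈-upTo⁻ j∈
    a<1+b : a < suc b
    a<1+b = m∸n≢0⇒n<m (λ eq → n≮0 (subst (j <_) eq j<1+b∸a))

  ∈-range⁺ : ∀ {a b p} → a ≤ p → p ≤ b → p ∈ range a b
  ∈-range⁺ {a} {b} {p} a≤p p≤b =
    subst (_∈ range a b) (m+[n∸m]≡n a≤p) (∈-map⁺ (λ j → a + j) (∈-upTo⁺ (∸-monoˡ-< (s≤s p≤b) a≤p)))

module ChildCounts where
  open import Defs
  open import Data.Nat
  open import Data.Nat.Properties
  open import Data.Bool using (Bool; true; false; T; _∧_; if_then_else_)
  open import Data.Bool.Properties using (∧-assoc; ∧-identityʳ; ∧-zeroʳ; T-≡)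
  open import Data.Bool.ListAction using (and)
  open import Data.List using (List; []; _∷_; map; filterᵇ; length)
  open import Data.List.Properties using (map-cong)
  open import Data.List.Membership.Propositional using (_∈_)
  open import Data.List.Relation.Unary.All as All using (All; []; _∷_)
  open import Data.List.Relation.Unary.Any using (here; there)
  open import Data.List.Relation.Unary.AllPairs using ([]; _∷_)
  open import Data.List.Relation.Unary.Unique.Propositional using (Unique)
  open import Data.Empty using (⊥-elim)
  open import Data.Product using (_,_)
  open import Function.Bundles using (Equivalence)
  open import Data.Nat.Tactic.RingSolver using (solve-∀)
  open import Relation.Binary.PropositionalEquality

  indicator : Bool → ℕ
  indicator b = if b then 1 else 0

  count : ℕ → (ℕ → ℕ) → List ℕ → ℕ
  count k c vs = length (filterᵇ (λ v → c v ≡ᵇ k) vs)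

  count-cons : ∀ k c v vs → count k c (v ∷ vs) ≡ indicator (c v ≡ᵇ k) + count k c vs
  count-cons k c v vs with c v ≡ᵇ k
  ... | true  = refl
  ... | false = refl

  atMostTwo : (ℕ → ℕ) → List ℕ → Bool
  atMostTwo c vs = and (map (λ v → c v ≤ᵇ 2) vs)

  count-cong : ∀ k {c c′} vs → (∀ v → c v ≡ c′ v) → count k c vs ≡ count k c′ vs
  count-cong k {c} {c′} []       c≗c′ = refl
  count-cong k {c} {c′} (v ∷ vs) c≗c′ =
    trans (count-cons k c v vs)
   (trans (cong₂ (λ x y → indicator (x ≡ᵇ k) + y) (c≗c′ v) (count-cong k vs c≗c′))
          (sym (count-cons k c′ v vs)))

  atMostTwo-cong : ∀ {c c′} vs → (∀ v → c v ≡ c′ v) → atMostTwo c vs ≡ atMostTwo c′ vs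
  atMostTwo-cong vs c≗c′ = cong and (map-cong (λ v → cong (_≤ᵇ 2) (c≗c′ v)) vs)

  addChild : ℕ → (ℕ → ℕ) → ℕ → ℕ
  addChild p c v = if p ≡ᵇ v then suc (c v) else c v

  childCount-cons : ∀ a p t v → childCount ((a , p) ∷ t) v ≡ addChild p (childCount t) v
  childCount-cons a p t v with p ≡ᵇ v
  ... | true  = refl
  ... | false = refl

  addChild-here : ∀ p c → addChild p c p ≡ suc (c p)
  addChild-here p c rewrite Equivalence.to T-≡ (≡⇒≡ᵇ p p refl) = refl

  addChild-elsewhere : ∀ {p v} c → p ≢ v → addChild p c v ≡ c v
  addChild-elsewhere {p} {v} c p≢v with p ≡ᵇ v in eq
  ... | true  = ⊥-elim (p≢v (≡ᵇ⇒≡ p v (subst T (sym eq) _)))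
  ... | false = refl

  count-addChild-fresh : ∀ k p c {vs} → All (p ≢_) vs → count k (addChild p c) vs ≡ count k c vs
  count-addChild-fresh k p c {[]}     []           = refl
  count-addChild-fresh k p c {v ∷ vs} (p≢v ∷ fresh) =
    trans (count-cons k (addChild p c) v vs)
   (trans (cong₂ (λ x y → indicator (x ≡ᵇ k) + y) (addChild-elsewhere c p≢v) (count-addChild-fresh k p c fresh))
          (sym (count-cons k c v vs)))

  -- p moves from the class of c p children to the class of c p + 1 children
  count-addChild : ∀ k p c {vs} → Unique vs → p ∈ vs →
    count k (addChild p c) vs + indicator (c p ≡ᵇ k) ≡ count k c vs + indicator (suc (c p) ≡ᵇ k)
  count-addChild k p c {p ∷ vs} (fresh ∷ _) (here refl) =
    begin
      count k (addChild p c) (p ∷ vs) + old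
    ≡⟨ cong (_+ old) (trans (count-cons k (addChild p c) p vs)
                            (cong₂ (λ x y → indicator (x ≡ᵇ k) + y) (addChild-here p c) (count-addChild-fresh k p c fresh))) ⟩
      new + count k c vs + old
    ≡⟨ swap new (count k c vs) old ⟩
      old + count k c vs + new
    ≡⟨ cong (_+ new) (sym (count-cons k c p vs)) ⟩
      count k c (p ∷ vs) + new
    ∎
    where
    open ≡-Reasoning
    old new : ℕ
    old = indicator (c p ≡ᵇ k)
    new = indicator (suc (c p) ≡ᵇ k)
    swap : ∀ x y z → x + y + z ≡ z + y + x
    swap = solve-∀
  count-addChild k p c {v ∷ vs} (p′≢ ∷ unique) (there p∈) =
    begin
      count k (addChild p c) (v ∷ vs) + old
    ≡⟨ cong (_+ old) (trans (count-cons k (addChild p c) v vs)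
                            (cong (λ x → indicator (x ≡ᵇ k) + count k (addChild p c) vs) (addChild-elsewhere c p≢v))) ⟩
      here-v + count k (addChild p c) vs + old
    ≡⟨ +-assoc here-v _ old ⟩
      here-v + (count k (addChild p c) vs + old)
    ≡⟨ cong (here-v +_) (count-addChild k p c unique p∈) ⟩
      here-v + (count k c vs + new)
    ≡⟨ sym (+-assoc here-v _ new) ⟩
      here-v + count k c vs + new
    ≡⟨ cong (_+ new) (sym (count-cons k c v vs)) ⟩
      count k c (v ∷ vs) + new
    ∎
    where
    open ≡-Reasoning
    old new here-v : ℕ
    old = indicator (c p ≡ᵇ k)
    new = indicator (suc (c p) ≡ᵇ k)
    here-v = indicator (c v ≡ᵇ k)
    p≢v : p ≢ v
    p≢v p≡v = All.lookup p′≢ p∈ (sym p≡v)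

  atMostTwo-addChild-fresh : ∀ p c {vs} → All (p ≢_) vs → atMostTwo (addChild p c) vs ≡ atMostTwo c vs
  atMostTwo-addChild-fresh p c {[]}     []            = refl
  atMostTwo-addChild-fresh p c {v ∷ vs} (p≢v ∷ fresh) =
    cong₂ (λ x y → (x ≤ᵇ 2) ∧ y) (addChild-elsewhere c p≢v) (atMostTwo-addChild-fresh p c fresh)

  atMostTwo-addChild : ∀ p c {vs} → Unique vs → p ∈ vs →
    atMostTwo (addChild p c) vs ≡ atMostTwo c vs ∧ (c p ≤ᵇ 1)
  atMostTwo-addChild p c {p ∷ vs} (fresh ∷ _) (here refl) =
    trans (cong₂ (λ x y → (x ≤ᵇ 2) ∧ y) (addChild-here p c) (atMostTwo-addChild-fresh p c fresh))
          (absorb (c p) (atMostTwo c vs))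
    where
    absorb : ∀ x r → (suc x ≤ᵇ 2) ∧ r ≡ ((x ≤ᵇ 2) ∧ r) ∧ (x ≤ᵇ 1)
    absorb zero          r = sym (∧-identityʳ r)
    absorb (suc zero)    r = sym (∧-identityʳ r)
    absorb (suc (suc x)) r = sym (∧-zeroʳ ((suc (suc x) ≤ᵇ 2) ∧ r))
  atMostTwo-addChild p c {v ∷ vs} (p′≢ ∷ unique) (there p∈) =
    trans (cong₂ (λ x y → (x ≤ᵇ 2) ∧ y) (addChild-elsewhere c p≢v) (atMostTwo-addChild p c unique p∈))
          (sym (∧-assoc (c v ≤ᵇ 2) (atMostTwo c vs) (c p ≤ᵇ 1)))
    where
    p≢v : p ≢ v
    p≢v p≡v = All.lookup p′≢ p∈ (sym p≡v)

-- A tree is built by choosing parents for the vertices n-1, n-2, …, 1 in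
-- turn (n = m + 1).  Giving vertex a a parent p among a+1, …, n turns p
-- from a leaf into a unary vertex or from a unary into a binary vertex,
-- and adds the leaf a; this is exactly one application of grow.
module TreeSums (m : ℕ) where
  open import Defs
  open Grammar using (Weight; grow; grow^)
  open Ranges
  open ChildCounts
  open import Data.Nat
  open import Data.Nat.Properties
  open import Data.Bool using (Bool; true; false; _∧_; if_then_else_)
  open import Data.Bool.Properties using (∧-identityʳ; ∧-zeroʳ)
  open import Data.List using (List; []; _∷_; _++_; map; concatMap; foldr; filterᵇ)
  import Data.List.Properties as List
  open import Data.Nat.ListAction using (sum)
  open import Data.Nat.ListAction.Properties using (sum-++)
  open import Data.List.Membership.Propositional using (_∈_)
  open import Data.List.Relation.Unary.All as All using (All; []; _∷_)
  import Data.List.Relation.Unary.All.Properties as All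
  open import Data.Product using (_,_; proj₁; proj₂)
  open import Data.Nat.Tactic.RingSolver using (solve-∀)
  open import Relation.Binary.PropositionalEquality
  open ≡-Reasoning

  n : ℕ
  n = suc m

  extend : ℕ → List Edges → List Edges
  extend a ts = concatMap (λ t → map (λ p → (a , p) ∷ t) (range (suc a) n)) ts

  -- all choices of parents for the vertices a, …, n-1; partialMaps 1 = parentMaps n
  partialMaps : ℕ → List Edges
  partialMaps a = foldr extend ([] ∷ []) (range a (n ∸ 1))

  leaves unary : ℕ → Edges → ℕ
  leaves a t = count 0 (childCount t) (range a n)
  unary  a t = count 1 (childCount t) (range a n)

  weigh : ℕ → Weight → Edges → ℕ
  weigh a F t = if isOneTwo n t then F (leaves a t) (unary a t) else 0

  total : ℕ → Weight → List Edges → ℕ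
  total a F ts = sum (map (weigh a F) ts)

  total-++ : ∀ a F ts us → total a F (ts ++ us) ≡ total a F ts + total a F us
  total-++ a F ts us = trans (cong sum (List.map-++ (weigh a F) ts us)) (sum-++ (map (weigh a F) ts) _)

  ParentsAbove : ℕ → Edges → Set
  ParentsAbove a t = All (λ e → a < proj₂ e) t

  childless : ∀ {a t} → ParentsAbove (suc a) t → childCount t a ≡ 0
  childless {a} {[]}          []             = refl
  childless {a} {(x , q) ∷ t} (a+1<q ∷ above) =
    trans (childCount-cons x q t a)
          (trans (addChild-elsewhere (childCount t) (λ q≡a → <-irrefl (sym q≡a) (<-trans (n<1+n a) a+1<q)))
                 (childless above))

  module NewVertex (a : ℕ) (a<n : a < n) (t : Edges) (a-childless : childCount t a ≡ 0) (F : Weight) where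
    R : List ℕ
    R = range (suc a) n
    c : ℕ → ℕ
    c = childCount t
    i o : ℕ
    i = count 0 c R
    o = count 1 c R

    byChildren : ℕ → ℕ
    byChildren 0 = F i (suc o)
    byChildren 1 = F (suc i) (o ∸ 1)
    byChildren _ = 0

    -- In terms of the new numbers l of
    -- leaves and u of unary vertices among a+1, …, n (related to i, o by
    -- count-addChild) the weight is F(i, o+1) for x = 0, F(i+1, o-1) for
    -- x = 1, and for x ≥ 2 the result is not a 1-2 tree.
    settle : ∀ ok x l u → l + indicator (x ≡ᵇ 0) ≡ i + 0 → u + indicator (x ≡ᵇ 1) ≡ o + indicator (x ≡ᵇ 0) →
             (if ok ∧ (x ≤ᵇ 1) then F (suc l) u else 0) ≡ (if ok then byChildren x else 0)
    settle ok zero l u l+1≡i u≡o+1 rewrite ∧-identityʳ ok with ok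
    ... | false = refl
    ... | true  = cong₂ F (trans (+-comm 1 l) (trans l+1≡i (+-identityʳ i)))
                          (trans (sym (+-identityʳ u)) (trans u≡o+1 (+-comm o 1)))
    settle ok (suc zero) l u l≡i u+1≡o rewrite ∧-identityʳ ok with ok
    ... | false = refl
    ... | true  = cong₂ F (cong suc (trans (sym (+-identityʳ l)) (trans l≡i (+-identityʳ i))))
                          (sym (trans (cong (_∸ 1) (trans (sym (+-identityʳ o)) (sym u+1≡o))) (m+n∸n≡m u 1)))
    settle ok (suc (suc x)) l u _ _ rewrite ∧-zeroʳ ok with ok
    ... | false = refl
    ... | true  = refl

    attach : ∀ p → p ∈ R → weigh a F ((a , p) ∷ t) ≡ (if isOneTwo n t then byChildren (c p) else 0)
    attach p p∈R =
      begin
        weigh a F t′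
      ≡⟨ cong₂ (λ ok lu → if ok then F (proj₁ lu) (proj₂ lu) else 0) shape (cong₂ _,_ leaves′ unary′) ⟩
        (if isOneTwo n t ∧ (c p ≤ᵇ 1) then F (suc (count 0 c′ R)) (count 1 c′ R) else 0)
      ≡⟨ settle (isOneTwo n t) (c p) (count 0 c′ R) (count 1 c′ R)
                (count-addChild 0 p c (range-unique (suc a) n) p∈R)
                (count-addChild 1 p c (range-unique (suc a) n) p∈R) ⟩
        (if isOneTwo n t then byChildren (c p) else 0)
      ∎
      where
      t′ : Edges
      t′ = (a , p) ∷ t
      c′ : ℕ → ℕ
      c′ = addChild p c
      a<p : a < p
      a<p = proj₁ (∈-range⁻ p∈R)
      c′a≡0 : c′ a ≡ 0
      c′a≡0 = trans (addChild-elsewhere c (λ p≡a → <-irrefl (sym p≡a) a<p)) a-childless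
      shape : isOneTwo n t′ ≡ isOneTwo n t ∧ (c p ≤ᵇ 1)
      shape = trans (atMostTwo-cong (vertices n) (childCount-cons a p t))
                    (atMostTwo-addChild p c (range-unique 1 n)
                       (∈-range⁺ (≤-trans (s≤s z≤n) a<p) (proj₂ (∈-range⁻ p∈R))))
      -- a itself is a new leaf
      stats′ : ∀ k → count k (childCount t′) (range a n) ≡ indicator (c′ a ≡ᵇ k) + count k c′ R
      stats′ k = trans (count-cong k (range a n) (childCount-cons a p t))
                (trans (cong (count k c′) (range-cons (<⇒≤ a<n))) (count-cons k c′ a R))
      leaves′ : leaves a t′ ≡ suc (count 0 c′ R)
      leaves′ = trans (stats′ 0) (cong (λ x → indicator (x ≡ᵇ 0) + count 0 c′ R) c′a≡0)
      unary′ : unary a t′ ≡ count 1 c′ R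
      unary′ = trans (stats′ 1) (cong (λ x → indicator (x ≡ᵇ 1) + count 1 c′ R) c′a≡0)

    sum-byChildren : ∀ vs → sum (map (λ p → byChildren (c p)) vs) ≡ count 0 c vs * F i (suc o) + count 1 c vs * F (suc i) (o ∸ 1)
    sum-byChildren []       = refl
    sum-byChildren (v ∷ vs) =
      trans (cong₂ _+_ (split (c v)) (sum-byChildren vs))
     (trans (collect (indicator (c v ≡ᵇ 0)) (indicator (c v ≡ᵇ 1)) (count 0 c vs) (count 1 c vs) X Y)
            (sym (cong₂ (λ x y → x * X + y * Y) (count-cons 0 c v vs) (count-cons 1 c v vs))))
      where
      X Y : ℕ
      X = F i (suc o)
      Y = F (suc i) (o ∸ 1)
      split : ∀ x → byChildren x ≡ indicator (x ≡ᵇ 0) * X + indicator (x ≡ᵇ 1) * Y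
      split zero          = sym (trans (+-identityʳ (X + 0)) (+-identityʳ X))
      split (suc zero)    = sym (+-identityʳ Y)
      split (suc (suc x)) = refl
      collect : ∀ e f k l X Y → (e * X + f * Y) + (k * X + l * Y) ≡ (e + k) * X + (f + l) * Y
      collect = solve-∀

    attach-all : total a F (map (λ p → (a , p) ∷ t) R) ≡ weigh (suc a) (grow F) t
    attach-all =
      begin
        total a F (map (λ p → (a , p) ∷ t) R)
      ≡⟨ cong sum (sym (List.map-∘ R)) ⟩
        sum (map (λ p → weigh a F ((a , p) ∷ t)) R)
      ≡⟨ cong sum (List.map-cong-local (All.tabulate (λ {p} → attach p))) ⟩
        sum (map (λ p → if isOneTwo n t then byChildren (c p) else 0) R)
      ≡⟨ by-shape (isOneTwo n t) ⟩
        weigh (suc a) (grow F) t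
      ∎
      where
      by-shape : ∀ ok → sum (map (λ p → if ok then byChildren (c p) else 0) R) ≡ (if ok then grow F i o else 0)
      by-shape true  = sum-byChildren R
      by-shape false = zeros R
        where
        zeros : ∀ vs → sum (map (λ _ → 0) vs) ≡ 0
        zeros []       = refl
        zeros (_ ∷ vs) = zeros vs

  extend-total : ∀ a → a < n → ∀ F ts → All (ParentsAbove (suc a)) ts →
                 total a F (extend a ts) ≡ total (suc a) (grow F) ts
  extend-total a a<n F []       []             = refl
  extend-total a a<n F (t ∷ ts) (above ∷ aboves) =
    trans (total-++ a F (map (λ p → (a , p) ∷ t) (range (suc a) n)) (extend a ts))
          (cong₂ _+_ (NewVertex.attach-all a a<n t (childless above) F) (extend-total a a<n F ts aboves))

  extend-above : ∀ a ts → All (ParentsAbove (suc a)) ts → All (ParentsAbove a) (extend a ts)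
  extend-above a []       []             = []
  extend-above a (t ∷ ts) (above ∷ aboves) =
    All.++⁺ (All.map⁺ (All.tabulate (λ p∈ → proj₁ (∈-range⁻ p∈) ∷ All.map (<-trans (n<1+n a)) above)))
            (extend-above a ts aboves)

  partialMaps-suc : ∀ {a} → a < n → partialMaps a ≡ extend a (partialMaps (suc a))
  partialMaps-suc a<n = cong (foldr extend ([] ∷ [])) (range-cons (s≤s⁻¹ a<n))

  partialMaps-n : partialMaps n ≡ [] ∷ []
  partialMaps-n = cong (foldr extend ([] ∷ [])) (range-empty m)

  +suc≡n⇒< : ∀ {a k} → a + suc k ≡ n → a < n
  +suc≡n⇒< {a} a+k≡n = subst (a <_) a+k≡n (m<m+n a z<s)

  +suc≡n⇒suc+ : ∀ {a k} → a + suc k ≡ n → suc a + k ≡ n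
  +suc≡n⇒suc+ {a} {k} a+k≡n = trans (sym (+-suc a k)) a+k≡n

  partialMaps-above : ∀ k a → a + k ≡ n → All (ParentsAbove a) (partialMaps a)
  partialMaps-above zero    a a+0≡n rewrite +-identityʳ a | a+0≡n | partialMaps-n = [] ∷ []
  partialMaps-above (suc k) a a+k≡n =
    subst (All (ParentsAbove a)) (sym (partialMaps-suc (+suc≡n⇒< a+k≡n)))
          (extend-above a (partialMaps (suc a)) (partialMaps-above k (suc a) (+suc≡n⇒suc+ a+k≡n)))

  no-children : ∀ vs → atMostTwo (λ _ → 0) vs ≡ true
  no-children []       = refl
  no-children (_ ∷ vs) = no-children vs

  range-single : range n n ≡ n ∷ []
  range-single = trans (range-cons ≤-refl) (cong (n ∷_) (range-empty n))

  total-single : ∀ F → total n F ([] ∷ []) ≡ F 1 0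
  total-single F rewrite no-children (vertices n) | range-single = +-identityʳ (F 1 0)

  total-partialMaps : ∀ k a → a + k ≡ n → ∀ F → total a F (partialMaps a) ≡ grow^ k F 1 0
  total-partialMaps zero    a a+0≡n F rewrite +-identityʳ a | a+0≡n | partialMaps-n = total-single F
  total-partialMaps (suc k) a a+k≡n F =
    begin
      total a F (partialMaps a)
    ≡⟨ cong (total a F) (partialMaps-suc a<n) ⟩
      total a F (extend a (partialMaps (suc a)))
    ≡⟨ extend-total a a<n F (partialMaps (suc a)) (partialMaps-above k (suc a) a+1+k≡n) ⟩
      total (suc a) (grow F) (partialMaps (suc a))
    ≡⟨ total-partialMaps k (suc a) a+1+k≡n (grow F) ⟩
      grow^ k (grow F) 1 0
    ∎
    where
    a<n : a < n
    a<n = +suc≡n⇒< a+k≡n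
    a+1+k≡n : suc a + k ≡ n
    a+1+k≡n = +suc≡n⇒suc+ a+k≡n

  sum-filter : ∀ (P : Edges → Bool) (g : Edges → ℕ) ts →
               sum (map g (filterᵇ P ts)) ≡ sum (map (λ t → if P t then g t else 0) ts)
  sum-filter P g []       = refl
  sum-filter P g (t ∷ ts) with P t
  ... | true  = cong (g t +_) (sum-filter P g ts)
  ... | false = sum-filter P g ts

  tree-sum : ∀ F → sum (map (λ t → F (leaves 1 t) (unary 1 t)) (trees12 n)) ≡ grow^ m F 1 0
  tree-sum F = trans (sum-filter (isOneTwo n) (λ t → F (leaves 1 t) (unary 1 t)) (parentMaps n))
                     (total-partialMaps m 1 refl F)

module LeafSeries where
  open import Defs
  open PowerSeries
  open Grammar
  open import Data.Nat as ℕ using (zero; suc)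
  import Data.Nat.Tactic.RingSolver as NatSolver
  open import Data.Integer using (+_; _+_; _-_; _*_)
  import Data.Integer.Properties as ℤP
  open import Data.Integer.Tactic.RingSolver using (solve-∀)
  open import Relation.Binary.PropositionalEquality
  open ≡-Reasoning

  -- In a 1-2 tree with m + 1 vertices, 2 · leaves + unary = m + 2; summed
  -- over all trees via grow this reads: leaves plus aₘ₊₁ is (m + 2) aₘ.
  leaf-identity : ∀ m → grow^ m (λ i _ → i) 1 0 ℕ.+ grow^ (suc m) one 1 0 ≡ suc (suc m) ℕ.* grow^ m one 1 0
  leaf-identity m =
    begin
      grow^ m (λ i _ → i) 1 0 ℕ.+ grow^ m (grow one) 1 0
    ≡⟨ sym (grow^-+ m (λ i _ → i) (grow one) 1 0) ⟩
      grow^ m (λ i j → i ℕ.+ grow one i j) 1 0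
    ≡⟨ grow^-cong m 2i+j 1 0 ⟩
      grow^ m (weighted 0 one) 1 0
    ≡⟨ grow^-weighted m 0 one 1 0 ⟩
      (m ℕ.+ 0 ℕ.+ 2) ℕ.* grow^ m one 1 0
    ≡⟨ cong (ℕ._* grow^ m one 1 0) (two m) ⟩
      suc (suc m) ℕ.* grow^ m one 1 0
    ∎
    where
    2i+j : ∀ i j → i ℕ.+ (i ℕ.* 1 ℕ.+ j ℕ.* 1) ≡ (0 ℕ.+ (i ℕ.+ i ℕ.+ j)) ℕ.* 1
    2i+j = NatSolver.solve-∀
    two : ∀ m → m ℕ.+ 0 ℕ.+ 2 ≡ suc (suc m)
    two = NatSolver.solve-∀

  A0-suc : ∀ m → A0 (suc m) ≡ grow^ m (λ i _ → i) 1 0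
  A0-suc m = TreeSums.tree-sum m (λ i _ → i)

  -- coefficientwise: A₀,ₘ₊₁ = (m+2) aₘ - aₘ₊₁ with bₘ₊₁ = aₘ, and A₀,₀ = 0
  A0-formula : A0EGF ≗ ((zEGF ⊙ aSeq) ⊖ aSeq) ⊕ bSeq
  A0-formula zero    = refl
  A0-formula (suc m) =
    begin
      + A0 (suc m)
    ≡⟨ cong +_ (A0-suc m) ⟩
      + L
    ≡⟨ undo (+ L) (aSeq (suc m)) ⟩
      (+ L + aSeq (suc m)) - aSeq (suc m)
    ≡⟨ cong (λ x → x - aSeq (suc m)) (trans (sym (ℤP.pos-+ L (grow^ (suc m) one 1 0)))
                                      (trans (cong +_ (leaf-identity m)) (ℤP.pos-* (suc (suc m)) (grow^ m one 1 0)))) ⟩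
      + suc (suc m) * aSeq m - aSeq (suc m)
    ≡⟨ cong (λ c → c * aSeq m - aSeq (suc m)) (ℤP.pos-+ 1 (suc m)) ⟩
      (+ 1 + + suc m) * aSeq m - aSeq (suc m)
    ≡⟨ rearrange (+ suc m) (aSeq m) (aSeq (suc m)) ⟩
      (+ suc m * aSeq m - aSeq (suc m)) + aSeq m
    ≡⟨ sym (cong₂ (λ x y → x - aSeq (suc m) + y) (z⊙-suc aSeq m) (D-bSeq m)) ⟩
      (zEGF ⊙ aSeq) (suc m) - aSeq (suc m) + bSeq (suc m)
    ∎
    where
    L : ℕ
    L = grow^ m (λ i _ → i) 1 0
    undo : ∀ x y → x ≡ (x + y) - y
    undo = solve-∀
    rearrange : ∀ c x y → (+ 1 + c) * x - y ≡ (c * x - y) + x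
    rearrange = solve-∀

open import Defs
open import Data.Integer using (_+_; _-_)
open import Relation.Binary.PropositionalEquality using (_≡_)

theorem2p2 : ∀ n → (A0EGF ⊙ (λ k → oneEGF k - sinEGF k)) n ≡ (zEGF n - oneEGF n) + cosEGF n
theorem2p2 n =
  begin
    (A0EGF ⊙ one-sin) n
  ≡⟨ ⊙-congˡ A0-formula one-sin n ⟩
    ((((zEGF ⊙ aSeq) ⊖ aSeq) ⊕ bSeq) ⊙ one-sin) n
  ≡⟨ ⊙-distribʳ ((zEGF ⊙ aSeq) ⊖ aSeq) bSeq one-sin n ⟩
    (((zEGF ⊙ aSeq) ⊖ aSeq) ⊙ one-sin) n + (bSeq ⊙ one-sin) n
  ≡⟨ cong (_+ (bSeq ⊙ one-sin) n) (⊙-distribʳ-⊖ (zEGF ⊙ aSeq) aSeq one-sin n) ⟩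
    ((zEGF ⊙ aSeq) ⊙ one-sin) n - (aSeq ⊙ one-sin) n + (bSeq ⊙ one-sin) n
  ≡⟨ cong (λ x → x - (aSeq ⊙ one-sin) n + (bSeq ⊙ one-sin) n) z⊙a⊙u≡z ⟩
    zEGF n - (aSeq ⊙ one-sin) n + (bSeq ⊙ one-sin) n
  ≡⟨ cong₂ (λ x y → zEGF n - x + y) (a⊙u≗1 n) (b⊙u≗cos n) ⟩
    zEGF n - oneEGF n + cosEGF n
  ∎
  where
  open PowerSeries
  open Grammar using (aSeq; bSeq; D-aSeq; D-bSeq)
  open Trigonometric using (one-sin)
  open TrigonometricSystem using (a⊙one-sin≗one; b⊙one-sin≗cos)
  open LeafSeries using (A0-formula)
  open import Relation.Binary.PropositionalEquality using (_≗_; refl; trans; cong; cong₂; module ≡-Reasoning)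
  open ≡-Reasoning
  a⊙u≗1 : (aSeq ⊙ one-sin) ≗ oneEGF
  a⊙u≗1 = a⊙one-sin≗one aSeq bSeq D-aSeq D-bSeq refl refl
  b⊙u≗cos : (bSeq ⊙ one-sin) ≗ cosEGF
  b⊙u≗cos = b⊙one-sin≗cos aSeq bSeq D-aSeq D-bSeq refl refl
  z⊙a⊙u≡z : ((zEGF ⊙ aSeq) ⊙ one-sin) n ≡ zEGF n
  z⊙a⊙u≡z = trans (⊙-assoc zEGF aSeq one-sin n) (trans (⊙-congʳ zEGF a⊙u≗1 n) (⊙-identityʳ zEGF n))
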